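{- In any Q-structure, for any facts $F,G$ the following are equivalent: - $\mathbf1\subseteq F\wp G$; - $1\in F\wp G$; - $G^\perp\subseteq F$; - $F^\perp\subseteq G$; - $1\in G\wp F$.
   Context: A Q-structure is a tuple $\langle\mathcal P,\mathcal Z,\cdot,1\rangle$ with $\mathcal P$ a set, $\mathcal Z\subseteq\mathcal P$, $\cdot$ a binary operation on $\mathcal P$ (not assumed associative or commutative), and $1\in\mathcal P$. These satisfy, for all $x,y,z$: $x\cdot y\in\mathcal Z$ iff $y\cdot x\in\mathcal Z$; $(x\cdot y)\cdot z\in\mathcal Z$ iff $x\cdot(z\cdot y)\in\mathcal Z$; and $1\cdot x=x\cdot1=x$. For $A\subseteq\mathcal P$, $A^\perp=\{b: b\cdot a\in\mathcal Z\ \forall a\in A\}$. A fact is a subset $F$ with $F=(F^\perp)^\perp$. For $A,B\subseteq\mathcal P$, $A\cdot B=\{a\cdot b:a\in A,b\in B\}$. Par on facts: $F\wp G=(F^\perp\cdot G^\perp)^\perp$. Also $\mathbf1=\mathcal Z^\perp$. -}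

module Defs where

open import Level using (Level; suc)
open import Data.Product using (Σ; ∃; _×_; _,_)
open import Relation.Binary.PropositionalEquality using (_≡_)
open import Relation.Unary using (Pred; _∈_; _⊆_)

record QStructure (ℓ : Level) : Set (suc ℓ) where
  field
    Carrier : Set ℓ
    Z       : Pred Carrier ℓ
    _·_     : Carrier → Carrier → Carrier
    one     : Carrier
    comm-Z  : ∀ x y → ((x · y) ∈ Z → (y · x) ∈ Z) × ((y · x) ∈ Z → (x · y) ∈ Z)
    assoc-Z : ∀ x y z → (((x · y) · z) ∈ Z → (x · (z · y)) ∈ Z)
                      × ((x · (z · y)) ∈ Z → ((x · y) · z) ∈ Z)
    unitˡ   : ∀ x → one · x ≡ x
    unitʳ   : ∀ x → x · one ≡ x

module QOps {ℓ : Level} (Q : QStructure ℓ) where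
  open QStructure Q

  _⊥ : Pred Carrier ℓ → Pred Carrier ℓ
  (A ⊥) b = ∀ a → a ∈ A → (b · a) ∈ Z

  _⊙_ : Pred Carrier ℓ → Pred Carrier ℓ → Pred Carrier ℓ
  (A ⊙ B) c = Σ Carrier λ a → Σ Carrier λ b → a ∈ A × b ∈ B × c ≡ (a · b)

  IsFact : Pred Carrier ℓ → Set ℓ
  IsFact F = (F ⊆ ((F ⊥) ⊥)) × (((F ⊥) ⊥) ⊆ F)

  _℘_ : Pred Carrier ℓ → Pred Carrier ℓ → Pred Carrier ℓ
  F ℘ G = ((F ⊥) ⊙ (G ⊥)) ⊥

  𝟏 : Pred Carrier ℓ
  𝟏 = Z ⊥

{-# OPTIONS --safe #-}
module Submission where

open import Defs
open import Level using (Level)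
open import Data.Product using (_×_; _,_; proj₁)
open import Function.Bundles using (_⇔_; mk⇔)
open import Function.Construct.Composition using (_⇔-∘_)
open import Function.Construct.Symmetry using (⇔-sym)
open import Relation.Unary using (Pred; _∈_; _⊆_)
open import Relation.Binary.PropositionalEquality using (refl; subst; sym)

-- Every condition says that F^⊥ · G^⊥ ⊆ Z.  For any A, both 𝟏 ⊆ A^⊥ and
-- 1 ∈ A^⊥ amount to A ⊆ Z by the unit law, which handles the par conditions;
-- since F = F^⊥⊥, G^⊥ ⊆ F says that every b ∈ G^⊥ is orthogonal to F^⊥, the
-- same condition up to commutativity of Z, which also makes it symmetric in
-- F and G.

module _ {ℓ : Level} (Q : QStructure ℓ) where
  open QStructure Q
  open QOps Q

  Orthogonal : Pred Carrier ℓ → Pred Carrier ℓ → Set ℓ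
  Orthogonal A B = ∀ {a b} → a ∈ A → b ∈ B → (a · b) ∈ Z

  swap-Z : ∀ {x y} → (x · y) ∈ Z → (y · x) ∈ Z
  swap-Z {x} {y} = proj₁ (comm-Z x y)

  one∈⊥⇔⊆Z : (A : Pred Carrier ℓ) → (one ∈ (A ⊥)) ⇔ (A ⊆ Z)
  one∈⊥⇔⊆Z A = mk⇔
    (λ one∈A⊥ {a} a∈A → subst Z (unitˡ a) (one∈A⊥ a a∈A))
    (λ A⊆Z a a∈A → subst Z (sym (unitˡ a)) (A⊆Z a∈A))

  𝟏⊆⊥⇔one∈⊥ : (A : Pred Carrier ℓ) → (𝟏 ⊆ (A ⊥)) ⇔ (one ∈ (A ⊥))
  𝟏⊆⊥⇔one∈⊥ A = mk⇔
    (λ 𝟏⊆A⊥ → 𝟏⊆A⊥ (λ z z∈Z → subst Z (sym (unitˡ z)) z∈Z))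
    (λ one∈A⊥ {x} x∈𝟏 a a∈A → x∈𝟏 a (subst Z (unitˡ a) (one∈A⊥ a a∈A)))

  ⊙⊆Z⇔Orthogonal : (A B : Pred Carrier ℓ) → ((A ⊙ B) ⊆ Z) ⇔ Orthogonal A B
  ⊙⊆Z⇔Orthogonal A B = mk⇔
    (λ A⊙B⊆Z {a} {b} a∈A b∈B → A⊙B⊆Z (_ , _ , a∈A , b∈B , refl))
    (λ { orth (_ , _ , a∈A , b∈B , refl) → orth a∈A b∈B })

  one∈℘⇔Orthogonal : (F G : Pred Carrier ℓ) →
                     (one ∈ (F ℘ G)) ⇔ Orthogonal (F ⊥) (G ⊥)
  one∈℘⇔Orthogonal F G =
    ⊙⊆Z⇔Orthogonal (F ⊥) (G ⊥) ⇔-∘ one∈⊥⇔⊆Z ((F ⊥) ⊙ (G ⊥))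

  ⊥⊆fact⇔Orthogonal : (F G : Pred Carrier ℓ) → IsFact F →
                      ((G ⊥) ⊆ F) ⇔ Orthogonal (F ⊥) (G ⊥)
  ⊥⊆fact⇔Orthogonal F G (_ , F⊥⊥⊆F) = mk⇔
    (λ G⊥⊆F {a} {b} a∈F⊥ b∈G⊥ → a∈F⊥ _ (G⊥⊆F b∈G⊥))
    (λ orth {b} b∈G⊥ → F⊥⊥⊆F (λ a a∈F⊥ → swap-Z (orth a∈F⊥ b∈G⊥)))

  Orthogonal-sym : (A B : Pred Carrier ℓ) → Orthogonal A B ⇔ Orthogonal B A
  Orthogonal-sym A B = mk⇔ flip flip
    where
    flip : ∀ {A B} → Orthogonal A B → Orthogonal B A
    flip orth b∈B a∈A = swap-Z (orth a∈A b∈B)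

corollary1 : {ℓ : Level} (Q : QStructure ℓ) →
    let open QStructure Q in let open QOps Q in
    (F G : Pred Carrier ℓ) → IsFact F → IsFact G →
    ((𝟏 ⊆ (F ℘ G)) ⇔ (one ∈ (F ℘ G)))
    × ((one ∈ (F ℘ G)) ⇔ ((G ⊥) ⊆ F))
    × (((G ⊥) ⊆ F) ⇔ ((F ⊥) ⊆ G))
    × (((F ⊥) ⊆ G) ⇔ (one ∈ (G ℘ F)))
corollary1 Q F G F-fact G-fact =
    𝟏⊆⊥⇔one∈⊥ Q ((F ⊥) ⊙ (G ⊥))
  , ⇔-sym G⊥⊆F⇔ ⇔-∘ one∈℘⇔Orthogonal Q F G
  , ⇔-sym F⊥⊆G⇔ ⇔-∘ (Orthogonal-sym Q (F ⊥) (G ⊥) ⇔-∘ G⊥⊆F⇔)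
  , ⇔-sym (one∈℘⇔Orthogonal Q G F) ⇔-∘ F⊥⊆G⇔
  where
  open QOps Q
  G⊥⊆F⇔ : ((G ⊥) ⊆ F) ⇔ Orthogonal Q (F ⊥) (G ⊥)
  G⊥⊆F⇔ = ⊥⊆fact⇔Orthogonal Q F G F-fact
  F⊥⊆G⇔ : ((F ⊥) ⊆ G) ⇔ Orthogonal Q (G ⊥) (F ⊥)
  F⊥⊆G⇔ = ⊥⊆fact⇔Orthogonal Q G F G-fact
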